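{- Let $X=\{X_1,X_2\}$ be a $\lambda_2$-equitable $2$-partition of $J(n,3)$ with quotient matrix $(p_{ij})$ satisfying $p_{11}\geq p_{22}$ and $p_{11}\geq 2n-7$, and assume no vertex is of type (I) or (II). Let $\{a,b,c\}$ be a vertex with $\overline{abc}=1$ and let $d\in[n]\setminus\{a,b,c\}$ be such that $(\overline{abd},\overline{acd},\overline{bcd})=(1,1,1)$ and $(\overline{abf},\overline{acf},\overline{bcf})=(1,1,0)$ for every $f\in[n]\setminus\{a,b,c,d\}$. Then $n\leq 8$.
   Context: $J(n,3)$: vertices are the $3$-subsets of $[n]$, adjacent iff they share exactly two elements; it is $3(n-3)$-regular. An equitable $2$-partition with quotient matrix $(p_{ij})$ means each vertex of $X_i$ has exactly $p_{ij}$ neighbours in $X_j$; $\lambda_2$-equitable means $p_{11}-p_{21}=n-7$. $\overline{u}=1$ if $u\in X_1$, else $0$; $\overline{xyz}=\overline{\{x,y,z\}}$; $\overline{ij\ast}$ is the number of $3$-subsets containing $i,j$ lying in $X_1$. A vertex $v=\{x,y,z\}\in X_1$, labelled so that $\overline{xy\ast}\geq\overline{xz\ast}\geq\overline{yz\ast}$, is of type (I) if $(\overline{xy\ast}-\overline{xz\ast},\overline{xz\ast}-\overline{yz\ast})=(n-4,0)$ and of type (II) if this pair equals $((n-4)/2,(n-4)/2)$. -}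

module Defs where

open import Data.Bool using (Bool; true; false; _∧_; if_then_else_)
open import Data.Nat using (ℕ; zero; suc; _≡ᵇ_)
open import Data.Fin using (Fin)
open import Data.Fin.Subset using (Subset; ∣_∣; _∩_; _∪_; ⁅_⁆)
open import Data.Vec using (_∷_; []; lookup)
open import Data.List using (List; _∷_; []; map; _++_; filterᵇ; length)
open import Data.Integer using (ℤ; +_; _-_; _*_; _≤_)
open import Data.Product using (Σ; _×_; ∃)
open import Relation.Binary.PropositionalEquality using (_≡_; _≢_)
open import Relation.Nullary using (¬_)

allSubsets : (n : ℕ) → List (Subset n)
allSubsets zero = [] ∷ []
allSubsets (suc n) = map (true ∷_) (allSubsets n) ++ map (false ∷_) (allSubsets n)

IsVertex : {n : ℕ} → Subset n → Set
IsVertex s = ∣ s ∣ ≡ 3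

vertices : (n : ℕ) → List (Subset n)
vertices n = filterᵇ (λ s → ∣ s ∣ ≡ᵇ 3) (allSubsets n)

adjᵇ : {n : ℕ} → Subset n → Subset n → Bool
adjᵇ v w = ∣ v ∩ w ∣ ≡ᵇ 2

-- A 2-partition is given by the indicator χ of X₁ (χ v = true iff v ∈ X₁);
-- X₂ is the set of vertices with χ v = false.
-- number of neighbours of v in X₁ and in X₂
nbrsIn₁ : {n : ℕ} → (Subset n → Bool) → Subset n → ℕ
nbrsIn₁ {n} χ v = length (filterᵇ (λ w → adjᵇ v w ∧ χ w) (vertices n))

nbrsIn₂ : {n : ℕ} → (Subset n → Bool) → Subset n → ℕ
nbrsIn₂ {n} χ v = length (filterᵇ (λ w → adjᵇ v w ∧ (if χ w then false else true)) (vertices n))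

record Equitable2Partition (n : ℕ) (χ : Subset n → Bool) (p₁₁ p₁₂ p₂₁ p₂₂ : ℕ) : Set where
  field
    X₁-nonempty : ∃ λ v → IsVertex v × χ v ≡ true
    X₂-nonempty : ∃ λ v → IsVertex v × χ v ≡ false
    row₁₁ : ∀ v → IsVertex v → χ v ≡ true → nbrsIn₁ χ v ≡ p₁₁
    row₁₂ : ∀ v → IsVertex v → χ v ≡ true → nbrsIn₂ χ v ≡ p₁₂
    row₂₁ : ∀ v → IsVertex v → χ v ≡ false → nbrsIn₁ χ v ≡ p₂₁
    row₂₂ : ∀ v → IsVertex v → χ v ≡ false → nbrsIn₂ χ v ≡ p₂₂

Lambda2 : ℕ → ℕ → ℕ → Set
Lambda2 n p₁₁ p₂₁ = (+ p₁₁) - (+ p₂₁) ≡ (+ n) - (+ 7)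

tri : {n : ℕ} → Fin n → Fin n → Fin n → Subset n
tri x y z = ⁅ x ⁆ ∪ ⁅ y ⁆ ∪ ⁅ z ⁆

bar : {n : ℕ} → (Subset n → Bool) → Fin n → Fin n → Fin n → Bool
bar χ x y z = χ (tri x y z)

pairCount : {n : ℕ} → (Subset n → Bool) → Fin n → Fin n → ℕ
pairCount {n} χ i j = length (filterᵇ (λ w → lookup w i ∧ lookup w j ∧ χ w) (vertices n))

Distinct3 : {n : ℕ} → Fin n → Fin n → Fin n → Set
Distinct3 x y z = x ≢ y × x ≢ z × y ≢ z

Labelled : {n : ℕ} → (Subset n → Bool) → Fin n → Fin n → Fin n → Set
Labelled χ x y z =
  Distinct3 x y z × bar χ x y z ≡ true ×
  (+ pairCount χ x z) ≤ (+ pairCount χ x y) × (+ pairCount χ y z) ≤ (+ pairCount χ x z)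

TypeI : (n : ℕ) → (Subset n → Bool) → Fin n → Fin n → Fin n → Set
TypeI n χ x y z = Labelled χ x y z ×
  ((+ pairCount χ x y) - (+ pairCount χ x z) ≡ (+ n) - (+ 4)) ×
  ((+ pairCount χ x z) - (+ pairCount χ y z) ≡ + 0)

-- type (II): (xy* - xz*, xz* - yz*) = ((n-4)/2, (n-4)/2)   (stated as 2·d = n-4)
TypeII : (n : ℕ) → (Subset n → Bool) → Fin n → Fin n → Fin n → Set
TypeII n χ x y z = Labelled χ x y z ×
  ((+ 2) * ((+ pairCount χ x y) - (+ pairCount χ x z)) ≡ (+ n) - (+ 4)) ×
  ((+ 2) * ((+ pairCount χ x z) - (+ pairCount χ y z)) ≡ (+ n) - (+ 4))

-- Let R be the m = n − 4 points outside {a,b,c,d}. Counting the X₁-neighbours of abc, abd and bcd gives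
-- p₁₁ = 3 + 2m and p₂₁ = 6 + m, and shows that adf ∉ X₁ while bdf, cdf ∈ X₁ for every f ∈ R. Counting at
-- abf, acf and bcf then shows that every f ∈ R has exactly m/2 partners g ∈ R with afg ∈ X₁. Colour a pair
-- {f,g} ⊆ R by whether afg ∈ X₁: the degree of afg determines how many fgk lie in X₁, and the degree of fgh
-- then rules out monochromatic triangles in R. If m ≥ 5, some f has three partners g, h, k, and among
-- f, g, h, k a monochromatic triangle appears; so m ≤ 4, i.e. n ≤ 8.

module Submission where

open import Algebra.Solver.IdempotentCommutativeMonoid as ∪-Solver using ()
open import Data.Bool as Bool using (Bool; true; false; _∧_; T)
open import Data.Bool.Properties using (∧-conicalˡ; ∧-conicalʳ; ∧-assoc; ∧-identityʳ; ∧-zeroʳ)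
open import Data.Fin using (Fin; zero; suc)
open import Data.Fin.Subset using (Subset; inside; outside; _∈_; _∉_; _⊆_; _∪_; _∩_; ⁅_⁆; ⊥; ⋃; ∣_∣)
open import Data.Fin.Subset.Properties
  using ( ∪-identityˡ; ∪-identityʳ; drop-there; x∈p∪q⁻; x∈p∪q⁺; p⊆p∪q; q⊆p∪q; x∈⁅x⁆; x∈⁅y⁆⇒x≡y
        ; x∉⁅y⁆⇒x≢y; ∉⊥; _∈?_; ⊆-antisym; ∪-idempotentCommutativeMonoid )
import Data.Integer as ℤ
import Data.Integer.Properties as ℤₚ
open import Data.Integer.Tactic.RingSolver using () renaming (solve-∀ to ℤ-solve-∀)
open import Data.List as List using (List; []; _∷_)
open import Data.List.Properties using (map-++; map-∘; map-cong)
open import Data.List.Relation.Binary.Pointwise using (Pointwise; []; _∷_)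
open import Data.List.Relation.Unary.All as All using (All; []; _∷_)
open import Data.List.Relation.Unary.AllPairs using (AllPairs; []; _∷_)
open import Data.Nat using (ℕ; zero; suc; _+_; _≤_; z≤n; s≤s; _≡ᵇ_)
open import Data.Nat.ListAction using (sum)
open import Data.Nat.ListAction.Properties using (sum-++)
open import Data.Nat.Properties
  using ( +-assoc; +-comm; +-suc; +-identityʳ; +-cancelˡ-≡; +-cancelʳ-≡; +-mono-≤; +-mono-<-≤; +-monoʳ-≤
        ; ≤-refl; ≤-reflexive; m≤n⇒m≤1+n; <⇒≱; <⇒≢; ≮⇒≥; m≤n⇒m<n∨m≡n; m≤n⇒∃[o]m+o≡n
        ; ≤-pred; suc-injective; ≡ᵇ⇒≡; m+n≡0⇒m≡0; +-commutativeSemigroup; module ≤-Reasoning )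
open import Algebra.Properties.CommutativeSemigroup +-commutativeSemigroup using (x∙yz≈y∙xz; interchange)
open import Data.Nat.Tactic.RingSolver using (solve-∀)
open import Data.Product using (∃-syntax; _×_; _,_; proj₁; proj₂)
open import Data.Sum as Sum using (_⊎_; inj₁; inj₂; [_,_]′)
open import Data.Vec using ([]; _∷_; lookup; here; there)
open import Data.Vec.Properties using (≡-dec; []=⇒lookup; lookup⇒[]=; lookup-zipWith)
open import Function using (_∘_)
open import Relation.Binary.Definitions using (DecidableEquality)
open import Relation.Binary.PropositionalEquality
  using (_≡_; _≢_; refl; sym; trans; cong; cong₂; subst; ≢-sym; module ≡-Reasoning)
open import Relation.Nullary using (¬_; contradiction; does; yes; no)
open import Relation.Nullary.Decidable using (dec-true; dec-false)

open import Defs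

private
  variable
    n : ℕ

  module ∪-solver {n : ℕ} = ∪-Solver (∪-idempotentCommutativeMonoid n)

open ∪-solver using (solve; _⊜_; _⊕_; id)

𝟙 : Bool → ℕ
𝟙 true  = 1
𝟙 false = 0

sumOutside : Subset n → (Fin n → ℕ) → ℕ
sumOutside []            w = 0
sumOutside (inside  ∷ S) w = sumOutside S (w ∘ suc)
sumOutside (outside ∷ S) w = w zero + sumOutside S (w ∘ suc)

countOutside : Subset n → (Fin n → Bool) → ℕ
countOutside S P = sumOutside S (𝟙 ∘ P)

∉-there : ∀ {i : Fin n} {b S} → i ∉ S → suc i ∉ b ∷ S
∉-there i∉S = i∉S ∘ drop-there

sumOutside-cong : ∀ (S : Subset n) {v w : Fin n → ℕ} →
  (∀ i → i ∉ S → v i ≡ w i) → sumOutside S v ≡ sumOutside S w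
sumOutside-cong []            eq = refl
sumOutside-cong (inside  ∷ S) eq = sumOutside-cong S (λ i i∉S → eq (suc i) (∉-there i∉S))
sumOutside-cong (outside ∷ S) eq =
  cong₂ _+_ (eq zero λ ()) (sumOutside-cong S (λ i i∉S → eq (suc i) (∉-there i∉S)))

sumOutside-split : ∀ (S : Subset n) {e} (w : Fin n → ℕ) → e ∉ S →
  sumOutside S w ≡ w e + sumOutside (⁅ e ⁆ ∪ S) w
sumOutside-split (inside  ∷ S) {zero}  w e∉S = contradiction here e∉S
sumOutside-split (outside ∷ S) {zero}  w e∉S = cong (λ T → w zero + sumOutside T (w ∘ suc)) (sym (∪-identityˡ S))
sumOutside-split (inside  ∷ S) {suc e} w e∉S = sumOutside-split S (w ∘ suc) (e∉S ∘ there)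
sumOutside-split (outside ∷ S) {suc e} w e∉S = begin
  w zero + sumOutside S (w ∘ suc)
    ≡⟨ cong (w zero +_) (sumOutside-split S (w ∘ suc) (e∉S ∘ there)) ⟩
  w zero + (w (suc e) + sumOutside (⁅ e ⁆ ∪ S) (w ∘ suc))
    ≡⟨ x∙yz≈y∙xz (w zero) (w (suc e)) _ ⟩
  w (suc e) + (w zero + sumOutside (⁅ e ⁆ ∪ S) (w ∘ suc))
    ∎
  where open ≡-Reasoning

sumOutside-+ : ∀ (S : Subset n) (v w : Fin n → ℕ) →
  sumOutside S (λ i → v i + w i) ≡ sumOutside S v + sumOutside S w
sumOutside-+ []            v w = refl
sumOutside-+ (inside  ∷ S) v w = sumOutside-+ S (v ∘ suc) (w ∘ suc)
sumOutside-+ (outside ∷ S) v w =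
  trans (cong (v zero + w zero +_) (sumOutside-+ S (v ∘ suc) (w ∘ suc))) (interchange (v zero) _ _ _)

sumOutside-0 : ∀ (S : Subset n) → sumOutside S (λ _ → 0) ≡ 0
sumOutside-0 []            = refl
sumOutside-0 (inside  ∷ S) = sumOutside-0 S
sumOutside-0 (outside ∷ S) = sumOutside-0 S

countOutside-≤ : ∀ (S : Subset n) P → countOutside S P ≤ countOutside S (λ _ → true)
countOutside-≤ []            P = z≤n
countOutside-≤ (inside  ∷ S) P = countOutside-≤ S (P ∘ suc)
countOutside-≤ (outside ∷ S) P with P zero
... | true  = s≤s (countOutside-≤ S (P ∘ suc))
... | false = m≤n⇒m≤1+n (countOutside-≤ S (P ∘ suc))

countOutside-all : ∀ (S : Subset n) {P} → (∀ i → i ∉ S → P i ≡ true) →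
  countOutside S P ≡ countOutside S (λ _ → true)
countOutside-all S P-true = sumOutside-cong S (λ i i∉S → cong 𝟙 (P-true i i∉S))

countOutside-none : ∀ (S : Subset n) {P} → (∀ i → i ∉ S → P i ≡ false) → countOutside S P ≡ 0
countOutside-none S P-false = trans (sumOutside-cong S (λ i i∉S → cong 𝟙 (P-false i i∉S))) (sumOutside-0 S)

countOutside-full⇒ : ∀ (S : Subset n) {P i} →
  countOutside S P ≡ countOutside S (λ _ → true) → i ∉ S → P i ≡ true
countOutside-full⇒ S {P} {i} full i∉S with P i in Pi
... | true  = refl
... | false = contradiction (≤-reflexive (sym full)) (<⇒≱ (begin-strict
  countOutside S P                                 ≡⟨ sumOutside-split S (𝟙 ∘ P) i∉S ⟩
  𝟙 (P i) + countOutside (⁅ i ⁆ ∪ S) P             ≡⟨ cong (λ b → 𝟙 b + countOutside (⁅ i ⁆ ∪ S) P) Pi ⟩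
  countOutside (⁅ i ⁆ ∪ S) P                       ≤⟨ countOutside-≤ (⁅ i ⁆ ∪ S) P ⟩
  countOutside (⁅ i ⁆ ∪ S) (λ _ → true)            <⟨ ≤-refl ⟩
  1 + countOutside (⁅ i ⁆ ∪ S) (λ _ → true)        ≡⟨ sumOutside-split S (λ _ → 1) i∉S ⟨
  countOutside S (λ _ → true)                      ∎))
  where open ≤-Reasoning

countOutside-≡0⇒ : ∀ (S : Subset n) {P i} → countOutside S P ≡ 0 → i ∉ S → P i ≡ false
countOutside-≡0⇒ S {P} {i} none i∉S with P i in Pi
... | false = refl
... | true  with trans (sym (sumOutside-split S (𝟙 ∘ P) i∉S)) none
...   | eq rewrite Pi with eq
...   | ()

countOutside-pick : ∀ (S : Subset n) P {k} → countOutside S P ≡ suc k →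
  ∃[ e ] e ∉ S × P e ≡ true × countOutside (⁅ e ⁆ ∪ S) P ≡ k
countOutside-pick []            P ()
countOutside-pick (inside ∷ S)  P eq with countOutside-pick S (P ∘ suc) eq
... | e , e∉S , Pe , rest = suc e , ∉-there e∉S , Pe , rest
countOutside-pick (outside ∷ S) P eq with P zero in P0
... | true  = zero , (λ ()) , P0 , trans (cong (λ T → countOutside T (P ∘ suc)) (∪-identityˡ S)) (suc-injective eq)
... | false with countOutside-pick S (P ∘ suc) eq
...   | e , e∉S , Pe , rest =
  suc e , ∉-there e∉S , Pe , trans (cong (λ b → 𝟙 b + countOutside (⁅ e ⁆ ∪ S) (P ∘ suc)) P0) rest

countOutside-⊥ : countOutside (⊥ {n}) (λ _ → true) ≡ n
countOutside-⊥ {zero}  = refl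
countOutside-⊥ {suc n} = cong suc (countOutside-⊥ {n})

∉-∪ : ∀ {i : Fin n} {p q} → i ∉ p → i ∉ q → i ∉ p ∪ q
∉-∪ {p = p} {q} i∉p i∉q i∈p∪q = [ i∉p , i∉q ]′ (x∈p∪q⁻ p q i∈p∪q)

∉-∪⁻ˡ : ∀ {i : Fin n} {p} q → i ∉ p ∪ q → i ∉ p
∉-∪⁻ˡ q i∉p∪q = i∉p∪q ∘ p⊆p∪q q

∉-∪⁻ʳ : ∀ {i : Fin n} p {q} → i ∉ p ∪ q → i ∉ q
∉-∪⁻ʳ p {q} i∉p∪q = i∉p∪q ∘ q⊆p∪q p q

≢⇒∉⁅⁆ : ∀ {i j : Fin n} → i ≢ j → i ∉ ⁅ j ⁆
≢⇒∉⁅⁆ {j = j} i≢j = i≢j ∘ x∈⁅y⁆⇒x≡y j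

countOutside-pick₃ : ∀ (S : Subset n) P {k} → countOutside S P ≡ 3 + k →
  ∃[ g ] ∃[ h ] ∃[ l ] g ∉ S × h ∉ S × l ∉ S × h ≢ g × l ≢ g × l ≢ h × P g ≡ true × P h ≡ true × P l ≡ true
countOutside-pick₃ S P eq
  with g , g∉S , Pg , rest₁ ← countOutside-pick S P eq
  with h , h∉g∪S , Ph , rest₂ ← countOutside-pick (⁅ g ⁆ ∪ S) P rest₁
  with l , l∉h∪g∪S , Pl , _ ← countOutside-pick (⁅ h ⁆ ∪ ⁅ g ⁆ ∪ S) P rest₂
  = g , h , l , g∉S , ∉-∪⁻ʳ ⁅ g ⁆ h∉g∪S , ∉-∪⁻ʳ ⁅ g ⁆ l∉g∪S
  , x∉⁅y⁆⇒x≢y (∉-∪⁻ˡ S h∉g∪S) , x∉⁅y⁆⇒x≢y (∉-∪⁻ˡ S l∉g∪S) , x∉⁅y⁆⇒x≢y (∉-∪⁻ˡ (⁅ g ⁆ ∪ S) l∉h∪g∪S)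
  , Pg , Ph , Pl
  where
  l∉g∪S : l ∉ ⁅ g ⁆ ∪ S
  l∉g∪S = ∉-∪⁻ʳ ⁅ h ⁆ l∉h∪g∪S

⋃⁅_⁆ : List (Fin n) → Subset n
⋃⁅ xs ⁆ = ⋃ (List.map ⁅_⁆ xs)

sumOutside-splitList : ∀ (S : Subset n) xs (w : Fin n → ℕ) → All (_∉ S) xs → AllPairs _≢_ xs →
  sumOutside S w ≡ sum (List.map w xs) + sumOutside (⋃⁅ xs ⁆ ∪ S) w
sumOutside-splitList S []       w []           []                  = cong (λ T → sumOutside T w) (sym (∪-identityˡ S))
sumOutside-splitList S (x ∷ xs) w (x∉S ∷ xs∉S) (x≢xs ∷ xs-distinct) = begin
  sumOutside S w
    ≡⟨ sumOutside-split S w x∉S ⟩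
  w x + sumOutside (⁅ x ⁆ ∪ S) w
    ≡⟨ cong (w x +_) (sumOutside-splitList _ xs w xs∉x∪S xs-distinct) ⟩
  w x + (sum (List.map w xs) + sumOutside (⋃⁅ xs ⁆ ∪ ⁅ x ⁆ ∪ S) w)
    ≡⟨ +-assoc (w x) _ _ ⟨
  w x + sum (List.map w xs) + sumOutside (⋃⁅ xs ⁆ ∪ ⁅ x ⁆ ∪ S) w
    ≡⟨ cong (λ T → _ + sumOutside T w) (∪-reassoc ⋃⁅ xs ⁆ ⁅ x ⁆ S) ⟩
  sum (List.map w (x ∷ xs)) + sumOutside (⋃⁅ x ∷ xs ⁆ ∪ S) w
    ∎
  where
  open ≡-Reasoning
  xs∉x∪S : All (_∉ ⁅ x ⁆ ∪ S) xs
  xs∉x∪S = All.zipWith (λ (y∉S , x≢y) → ∉-∪ (≢⇒∉⁅⁆ (≢-sym x≢y)) y∉S) (xs∉S , x≢xs)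
  ∪-reassoc : (p q r : Subset n) → p ∪ q ∪ r ≡ (q ∪ p) ∪ r
  ∪-reassoc = solve 3 (λ p q r → p ⊕ (q ⊕ r) ⊜ (q ⊕ p) ⊕ r) refl

countOutside-splitList : ∀ (S : Subset n) xs P {T} → All (_∉ S) xs → AllPairs _≢_ xs → ⋃⁅ xs ⁆ ∪ S ≡ T →
  countOutside S P ≡ sum (List.map (𝟙 ∘ P) xs) + countOutside T P
countOutside-splitList S xs P xs∉S distinct refl = sumOutside-splitList S xs (𝟙 ∘ P) xs∉S distinct

countOutside-split : ∀ (S : Subset n) xs P {T βs} → All (_∉ S) xs → AllPairs _≢_ xs → ⋃⁅ xs ⁆ ∪ S ≡ T →
  Pointwise (λ x β → P x ≡ β) xs βs → countOutside S P ≡ sum (List.map 𝟙 βs) + countOutside T P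
countOutside-split S xs P xs∉S distinct eqT values =
  trans (countOutside-splitList S xs P xs∉S distinct eqT) (cong (_+ _) (sum-values values))
  where
  sum-values : ∀ {xs βs} → Pointwise (λ x β → P x ≡ β) xs βs → sum (List.map (𝟙 ∘ P) xs) ≡ sum (List.map 𝟙 βs)
  sum-values []               = refl
  sum-values (Px≡β ∷ values) = cong₂ _+_ (cong 𝟙 Px≡β) (sum-values values)

countOutside-exchange : ∀ {S S′ T : Subset n} {u u′} P → u ∉ S → u′ ∉ S′ → ⁅ u ⁆ ∪ S ≡ T → ⁅ u′ ⁆ ∪ S′ ≡ T →
  countOutside S P + 𝟙 (P u′) ≡ 𝟙 (P u) + countOutside S′ P
countOutside-exchange {S = S} {S′} {T} {u} {u′} P u∉S u′∉S′ eq eq′ = begin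
  countOutside S P + 𝟙 (P u′)   ≡⟨ cong (_+ 𝟙 (P u′)) (split-at u u∉S eq) ⟩
  𝟙 (P u) + R + 𝟙 (P u′)       ≡⟨ +-assoc (𝟙 (P u)) R (𝟙 (P u′)) ⟩
  𝟙 (P u) + (R + 𝟙 (P u′))     ≡⟨ cong (𝟙 (P u) +_) (+-comm R (𝟙 (P u′))) ⟩
  𝟙 (P u) + (𝟙 (P u′) + R)     ≡⟨ cong (𝟙 (P u) +_) (split-at u′ u′∉S′ eq′) ⟨
  𝟙 (P u) + countOutside S′ P   ∎
  where
  open ≡-Reasoning
  R : ℕ
  R = countOutside T P
  split-at : ∀ {V} e → e ∉ V → ⁅ e ⁆ ∪ V ≡ T → countOutside V P ≡ 𝟙 (P e) + R
  split-at {V} e e∉V eqV = trans (sumOutside-split V (𝟙 ∘ P) e∉V) (cong (λ W → 𝟙 (P e) + countOutside W P) eqV)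

lookup-∈ : ∀ {i : Fin n} {s} → i ∈ s → lookup s i ≡ true
lookup-∈ = []=⇒lookup

lookup-∉ : ∀ {i : Fin n} {s} → i ∉ s → lookup s i ≡ false
lookup-∉ {i = i} {s} i∉s with lookup s i in eq
... | true  = contradiction (lookup⇒[]= i s eq) i∉s
... | false = refl

∣∣≡countOutside-⊥ : ∀ (s : Subset n) → ∣ s ∣ ≡ countOutside ⊥ (lookup s)
∣∣≡countOutside-⊥ []            = refl
∣∣≡countOutside-⊥ (inside  ∷ s) = cong suc (∣∣≡countOutside-⊥ s)
∣∣≡countOutside-⊥ (outside ∷ s) = ∣∣≡countOutside-⊥ s

∣∩∣≡countOutside-⊥ : ∀ (s t : Subset n) → ∣ s ∩ t ∣ ≡ countOutside ⊥ (λ i → lookup s i ∧ lookup t i)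
∣∩∣≡countOutside-⊥ s t =
  trans (∣∣≡countOutside-⊥ (s ∩ t)) (sumOutside-cong ⊥ (λ i _ → cong 𝟙 (lookup-zipWith _∧_ i s t)))

countOutside-self : ∀ (s : Subset n) → countOutside s (lookup s) ≡ 0
countOutside-self s = countOutside-none s (λ _ i∉s → lookup-∉ i∉s)

module _ {x y z : Fin n} where

  x∈tri : x ∈ tri x y z
  x∈tri = x∈p∪q⁺ (inj₁ (x∈⁅x⁆ x))

  y∈tri : y ∈ tri x y z
  y∈tri = x∈p∪q⁺ (inj₂ (x∈p∪q⁺ (inj₁ (x∈⁅x⁆ y))))

  z∈tri : z ∈ tri x y z
  z∈tri = x∈p∪q⁺ (inj₂ (x∈p∪q⁺ (inj₂ (x∈⁅x⁆ z))))

  ∉-tri : ∀ {i} → i ≢ x → i ≢ y → i ≢ z → i ∉ tri x y z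
  ∉-tri i≢x i≢y i≢z = ∉-∪ (≢⇒∉⁅⁆ i≢x) (∉-∪ (≢⇒∉⁅⁆ i≢y) (≢⇒∉⁅⁆ i≢z))

  ∉-tri⁻ : ∀ {i} → i ∉ tri x y z → i ≢ x × i ≢ y × i ≢ z
  ∉-tri⁻ i∉v = (λ { refl → i∉v x∈tri }) , (λ { refl → i∉v y∈tri }) , (λ { refl → i∉v z∈tri })

  ∈-tri⁻ : ∀ {i} → i ∈ tri x y z → i ≡ x ⊎ i ≡ y ⊎ i ≡ z
  ∈-tri⁻ i∈v =
    Sum.map (x∈⁅y⁆⇒x≡y x) (Sum.map (x∈⁅y⁆⇒x≡y y) (x∈⁅y⁆⇒x≡y z) ∘ x∈p∪q⁻ ⁅ y ⁆ ⁅ z ⁆) (x∈p∪q⁻ ⁅ x ⁆ _ i∈v)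

module _ (x y z : Fin n) where

  tri-swap₂₃ : tri x y z ≡ tri x z y
  tri-swap₂₃ = solve 3 (λ x y z → x ⊕ (y ⊕ z) ⊜ x ⊕ (z ⊕ y)) refl ⁅ x ⁆ ⁅ y ⁆ ⁅ z ⁆

  tri-rotate : tri x y z ≡ tri y z x
  tri-rotate = solve 3 (λ x y z → x ⊕ (y ⊕ z) ⊜ y ⊕ (z ⊕ x)) refl ⁅ x ⁆ ⁅ y ⁆ ⁅ z ⁆

  bar-swap₂₃ : ∀ χ → bar χ x y z ≡ bar χ x z y
  bar-swap₂₃ χ = cong χ tri-swap₂₃

  bar-rotate : ∀ χ → bar χ x y z ≡ bar χ y z x
  bar-rotate χ = cong χ tri-rotate

countOutside-⊥-tri : ∀ {x y z : Fin n} P → x ≢ y → x ≢ z → y ≢ z →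
  countOutside ⊥ P ≡ 𝟙 (P x) + (𝟙 (P y) + (𝟙 (P z) + 0)) + countOutside (tri x y z) P
countOutside-⊥-tri {x = x} {y} {z} P x≢y x≢z y≢z =
  countOutside-splitList ⊥ (x ∷ y ∷ z ∷ []) P (∉⊥ ∷ ∉⊥ ∷ ∉⊥ ∷ []) ((x≢y ∷ x≢z ∷ []) ∷ (y≢z ∷ []) ∷ [] ∷ [])
    (solve 3 (λ x y z → (x ⊕ (y ⊕ (z ⊕ id))) ⊕ id ⊜ x ⊕ (y ⊕ z)) refl ⁅ x ⁆ ⁅ y ⁆ ⁅ z ⁆)

∣tri∣≡3 : ∀ {x y z : Fin n} → x ≢ y → x ≢ z → y ≢ z → ∣ tri x y z ∣ ≡ 3
∣tri∣≡3 {x = x} {y} {z} x≢y x≢z y≢z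
  rewrite ∣∣≡countOutside-⊥ (tri x y z) | countOutside-⊥-tri (lookup (tri x y z)) x≢y x≢z y≢z
        | lookup-∈ (x∈tri {x = x} {y} {z}) | lookup-∈ (y∈tri {x = x} {y} {z}) | lookup-∈ (z∈tri {x = x} {y} {z})
        | countOutside-self (tri x y z) = refl

module _ {x y z : Fin n} (x≢y : x ≢ y) (x≢z : x ≢ z) (y≢z : y ≢ z) (s : Subset n) where

  ∣∣-tri : ∣ s ∣ ≡ 𝟙 (lookup s x) + (𝟙 (lookup s y) + (𝟙 (lookup s z) + 0)) + countOutside (tri x y z) (lookup s)
  ∣∣-tri = trans (∣∣≡countOutside-⊥ s) (countOutside-⊥-tri (lookup s) x≢y x≢z y≢z)

  ∣tri∩∣ : ∣ tri x y z ∩ s ∣ ≡ 𝟙 (lookup s x) + (𝟙 (lookup s y) + (𝟙 (lookup s z) + 0))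
  ∣tri∩∣
    rewrite ∣∩∣≡countOutside-⊥ (tri x y z) s
          | countOutside-⊥-tri (λ i → lookup (tri x y z) i ∧ lookup s i) x≢y x≢z y≢z
          | lookup-∈ (x∈tri {x = x} {y} {z}) | lookup-∈ (y∈tri {x = x} {y} {z}) | lookup-∈ (z∈tri {x = x} {y} {z})
          | countOutside-none (tri x y z) {λ i → lookup (tri x y z) i ∧ lookup s i}
              (λ _ i∉v → cong (_∧ _) (lookup-∉ i∉v))
    = +-identityʳ _

≡ᵇ-true⇒≡ : ∀ {m k} → (m ≡ᵇ k) ≡ true → m ≡ k
≡ᵇ-true⇒≡ {m} {k} eq = ≡ᵇ⇒≡ m k (subst T (sym eq) _)

neighbourᵇ : Subset n → Subset n → Bool
neighbourᵇ v s = (∣ s ∣ ≡ᵇ 3) ∧ adjᵇ v s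

tri-neighbour : ∀ {x y z g : Fin n} → x ≢ y → x ≢ z → y ≢ z → g ∉ tri x y z →
  neighbourᵇ (tri x y z) (tri x y g) ≡ true
tri-neighbour {x = x} {y} {z} {g} x≢y x≢z y≢z g∉v
  with g≢x , g≢y , g≢z ← ∉-tri⁻ g∉v
  rewrite ∣tri∣≡3 x≢y (≢-sym g≢x) (≢-sym g≢y) | ∣tri∩∣ x≢y x≢z y≢z (tri x y g)
        | lookup-∈ (x∈tri {x = x} {y} {g}) | lookup-∈ (y∈tri {x = x} {y} {g})
        | lookup-∉ (∉-tri {x = x} {y} {g} (≢-sym x≢z) (≢-sym y≢z) (≢-sym g≢z)) = refl

_≟ₛ_ : DecidableEquality (Subset n)
_≟ₛ_ = ≡-dec Bool._≟_

_==_ : Subset n → Subset n → Bool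
s == t = does (s ≟ₛ t)

tri-matches≡1 : ∀ (S : Subset n) {p q g} → p ∈ S → q ∈ S → g ∉ S →
  countOutside S (λ g′ → tri p q g == tri p q g′) ≡ 1
tri-matches≡1 S {p} {q} {g} p∈S q∈S g∉S = begin
  countOutside S (λ g′ → tri p q g == tri p q g′)                                          ≡⟨ sumOutside-split S _ g∉S ⟩
  𝟙 (tri p q g == tri p q g) + countOutside (⁅ g ⁆ ∪ S) (λ g′ → tri p q g == tri p q g′)  ≡⟨ cong₂ _+_ self others ⟩
  1 + 0                                                                                      ∎
  where
  open ≡-Reasoning
  self : 𝟙 (tri p q g == tri p q g) ≡ 1
  self = cong 𝟙 (dec-true (tri p q g ≟ₛ tri p q g) refl)
  others : countOutside (⁅ g ⁆ ∪ S) (λ g′ → tri p q g == tri p q g′) ≡ 0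
  others = countOutside-none _ λ g′ g′∉ →
    dec-false (tri p q g ≟ₛ tri p q g′) λ eq →
      ∉-tri (λ { refl → ∉-∪⁻ʳ ⁅ g ⁆ g′∉ p∈S }) (λ { refl → ∉-∪⁻ʳ ⁅ g ⁆ g′∉ q∈S }) (x∉⁅y⁆⇒x≢y (∉-∪⁻ˡ S g′∉))
        (subst (g′ ∈_) (sym eq) z∈tri)

matches≡0 : ∀ (S : Subset n) {s w} (t : Fin n → Subset n) → w ∉ s → (∀ g → w ∈ t g) →
  countOutside S (λ g → s == t g) ≡ 0
matches≡0 S {s} t w∉s w∈t = countOutside-none S (λ g _ → dec-false (s ≟ₛ t g) λ { refl → w∉s (w∈t g) })

adjacent-shape : ∀ {p q r : Fin n} s → lookup s p ≡ true → lookup s q ≡ true → lookup s r ≡ false →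
  countOutside (tri p q r) (lookup s) ≡ 1 → ∃[ g ] g ∉ tri p q r × s ≡ tri p q g
adjacent-shape {p = p} {q} {r} s sp sq sr one
  with g , g∉v , sg , rest ← countOutside-pick (tri p q r) (lookup s) one
  = g , g∉v , ⊆-antisym s⊆t t⊆s
  where
  s⊆t : s ⊆ tri p q g
  s⊆t {i} i∈s with i ∈? ⁅ g ⁆ ∪ tri p q r
  ... | no i∉ = contradiction (trans (sym (lookup-∈ i∈s)) (countOutside-≡0⇒ (⁅ g ⁆ ∪ tri p q r) rest i∉)) λ ()
  ... | yes i∈ with x∈p∪q⁻ ⁅ g ⁆ (tri p q r) i∈
  ...   | inj₁ i∈g = subst (_∈ tri p q g) (sym (x∈⁅y⁆⇒x≡y g i∈g)) z∈tri
  ...   | inj₂ i∈v with ∈-tri⁻ i∈v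
  ...     | inj₁ refl        = x∈tri
  ...     | inj₂ (inj₁ refl) = y∈tri
  ...     | inj₂ (inj₂ refl) = contradiction (trans (sym (lookup-∈ i∈s)) sr) λ ()
  t⊆s : tri p q g ⊆ s
  t⊆s i∈t with ∈-tri⁻ i∈t
  ... | inj₁ refl        = lookup⇒[]= _ s sp
  ... | inj₂ (inj₁ refl) = lookup⇒[]= _ s sq
  ... | inj₂ (inj₂ refl) = lookup⇒[]= _ s sg

module _ {x y z : Fin n} (x≢y : x ≢ y) (x≢z : x ≢ z) (y≢z : y ≢ z) where

  adjacent-indicator : ∀ s → ∣ s ∣ ≡ 3 → ∣ tri x y z ∩ s ∣ ≡ 2 →
    1 ≡ countOutside (tri x y z) (λ g → s == tri x y g)
      + (countOutside (tri x y z) (λ g → s == tri x z g) + countOutside (tri x y z) (λ g → s == tri y z g))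
  adjacent-indicator s size meet
    with lookup s x in sx | lookup s y in sy | lookup s z in sz
       | trans (sym size) (∣∣-tri x≢y x≢z y≢z s) | trans (sym meet) (∣tri∩∣ x≢y x≢z y≢z s)
  ... | true  | true  | true  | _     | ()
  ... | true  | false | false | _     | ()
  ... | false | true  | false | _     | ()
  ... | false | false | true  | _     | ()
  ... | false | false | false | _     | ()
  ... | true  | true  | false | size′ | _
    with g , g∉v , refl ← adjacent-shape s sx sy sz (sym (suc-injective (suc-injective size′)))
    with g≢x , g≢y , g≢z ← ∉-tri⁻ g∉v
    = sym (cong₂ _+_ (tri-matches≡1 (tri x y z) x∈tri y∈tri g∉v)
            (cong₂ _+_ (matches≡0 (tri x y z) (tri x z) z∉s (λ _ → y∈tri))
                       (matches≡0 (tri x y z) (tri y z) z∉s (λ _ → y∈tri))))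
    where
    z∉s : z ∉ tri x y g
    z∉s = ∉-tri (≢-sym x≢z) (≢-sym y≢z) (≢-sym g≢z)
  ... | true  | false | true  | size′ | _
    with g , g∉v′ , refl ← adjacent-shape s sx sz sy
           (subst (λ v → countOutside v (lookup s) ≡ 1) (tri-swap₂₃ x y z) (sym (suc-injective (suc-injective size′))))
    with g≢x , g≢z , g≢y ← ∉-tri⁻ g∉v′
    = sym (cong₂ _+_ (matches≡0 (tri x y z) (tri x y) y∉s (λ _ → y∈tri))
            (cong₂ _+_ (tri-matches≡1 (tri x y z) x∈tri z∈tri (∉-tri g≢x g≢y g≢z))
                       (matches≡0 (tri x y z) (tri y z) y∉s (λ _ → x∈tri))))
    where
    y∉s : y ∉ tri x z g
    y∉s = ∉-tri (≢-sym x≢y) y≢z (≢-sym g≢y)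
  ... | false | true  | true  | size′ | _
    with g , g∉v′ , refl ← adjacent-shape s sy sz sx
           (subst (λ v → countOutside v (lookup s) ≡ 1) (tri-rotate x y z) (sym (suc-injective (suc-injective size′))))
    with g≢y , g≢z , g≢x ← ∉-tri⁻ g∉v′
    = sym (cong₂ _+_ (matches≡0 (tri x y z) (tri x y) x∉s (λ _ → x∈tri))
            (cong₂ _+_ (matches≡0 (tri x y z) (tri x z) x∉s (λ _ → x∈tri))
                       (tri-matches≡1 (tri x y z) y∈tri z∈tri (∉-tri g≢x g≢y g≢z))))
    where
    x∉s : x ∉ tri y z g
    x∉s = ∉-tri x≢y x≢z (≢-sym g≢x)

  neighbour-indicator : ∀ s → 𝟙 (neighbourᵇ (tri x y z) s) ≡
    countOutside (tri x y z) (λ g → s == tri x y g)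
      + (countOutside (tri x y z) (λ g → s == tri x z g) + countOutside (tri x y z) (λ g → s == tri y z g))
  neighbour-indicator s with neighbourᵇ (tri x y z) s in nb
  ... | true  = adjacent-indicator s (≡ᵇ-true⇒≡ (∧-conicalˡ _ _ nb)) (≡ᵇ-true⇒≡ (∧-conicalʳ _ _ nb))
  ... | false =
    sym (cong₂ _+_ (never (tri x y) xy-neighbour)
                   (cong₂ _+_ (never (tri x z) xz-neighbour) (never (tri y z) yz-neighbour)))
    where
    never : ∀ t → (∀ g → g ∉ tri x y z → neighbourᵇ (tri x y z) (t g) ≡ true) →
      countOutside (tri x y z) (λ g → s == t g) ≡ 0
    never t neighbour = countOutside-none (tri x y z) λ g g∉v →
      dec-false (s ≟ₛ t g) λ { refl → contradiction (trans (sym nb) (neighbour g g∉v)) λ () }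
    xy-neighbour : ∀ g → g ∉ tri x y z → neighbourᵇ (tri x y z) (tri x y g) ≡ true
    xy-neighbour g g∉v = tri-neighbour x≢y x≢z y≢z g∉v
    xz-neighbour : ∀ g → g ∉ tri x y z → neighbourᵇ (tri x y z) (tri x z g) ≡ true
    xz-neighbour g g∉v = subst (λ v → neighbourᵇ v (tri x z g) ≡ true) (sym (tri-swap₂₃ x y z))
      (tri-neighbour x≢z x≢y (≢-sym y≢z) (subst (g ∉_) (tri-swap₂₃ x y z) g∉v))
    yz-neighbour : ∀ g → g ∉ tri x y z → neighbourᵇ (tri x y z) (tri y z g) ≡ true
    yz-neighbour g g∉v = subst (λ v → neighbourᵇ v (tri y z g) ≡ true) (sym (tri-rotate x y z))
      (tri-neighbour y≢z (≢-sym x≢y) (≢-sym x≢z) (subst (g ∉_) (tri-rotate x y z) g∉v))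

module _ {A : Set} where

  sum-map-0 : ∀ (xs : List A) → sum (List.map (λ _ → 0) xs) ≡ 0
  sum-map-0 []       = refl
  sum-map-0 (_ ∷ xs) = sum-map-0 xs

  sum-map-+ : ∀ (f g : A → ℕ) xs → sum (List.map (λ a → f a + g a) xs) ≡ sum (List.map f xs) + sum (List.map g xs)
  sum-map-+ f g []       = refl
  sum-map-+ f g (a ∷ xs) = trans (cong (f a + g a +_) (sum-map-+ f g xs)) (interchange (f a) _ _ _)

  sum-map-sumOutside : ∀ (S : Subset n) (F : A → Fin n → ℕ) xs →
    sum (List.map (λ a → sumOutside S (F a)) xs) ≡ sumOutside S (λ i → sum (List.map (λ a → F a i) xs))
  sum-map-sumOutside S F []       = sym (sumOutside-0 S)
  sum-map-sumOutside S F (a ∷ xs) =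
    trans (cong (sumOutside S (F a) +_) (sum-map-sumOutside S F xs)) (sym (sumOutside-+ S (F a) _))

  length-filterᵇ-filterᵇ : ∀ (p q : A → Bool) xs →
    List.length (List.filterᵇ p (List.filterᵇ q xs)) ≡ sum (List.map (λ a → 𝟙 (q a ∧ p a)) xs)
  length-filterᵇ-filterᵇ p q [] = refl
  length-filterᵇ-filterᵇ p q (a ∷ xs) with q a
  ... | false = length-filterᵇ-filterᵇ p q xs
  ... | true with p a
  ...   | true  = cong suc (length-filterᵇ-filterᵇ p q xs)
  ...   | false = length-filterᵇ-filterᵇ p q xs

sum-allSubsets-== : ∀ n (t : Subset n) (P : Subset n → Bool) →
  sum (List.map (λ s → 𝟙 ((s == t) ∧ P s)) (allSubsets n)) ≡ 𝟙 (P t)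
sum-allSubsets-== zero    []      P = +-identityʳ _
sum-allSubsets-== (suc n) (b ∷ t) P = begin
  sum (List.map f (List.map (true ∷_) A List.++ List.map (false ∷_) A))
    ≡⟨ cong sum (map-++ f (List.map (true ∷_) A) (List.map (false ∷_) A)) ⟩
  sum (List.map f (List.map (true ∷_) A) List.++ List.map f (List.map (false ∷_) A))
    ≡⟨ sum-++ (List.map f (List.map (true ∷_) A)) (List.map f (List.map (false ∷_) A)) ⟩
  sum (List.map f (List.map (true ∷_) A)) + sum (List.map f (List.map (false ∷_) A))
    ≡⟨ cong₂ _+_ (cong sum (sym (map-∘ A))) (cong sum (sym (map-∘ A))) ⟩
  sum (List.map (f ∘ (true ∷_)) A) + sum (List.map (f ∘ (false ∷_)) A)
    ≡⟨ split b ⟩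
  𝟙 (P (b ∷ t))
    ∎
  where
  open ≡-Reasoning
  A : List (Subset n)
  A = allSubsets n
  f : Subset (suc n) → ℕ
  f s = 𝟙 ((s == (b ∷ t)) ∧ P s)
  split : ∀ b → sum (List.map (λ s → 𝟙 (((true ∷ s) == (b ∷ t)) ∧ P (true ∷ s))) A)
              + sum (List.map (λ s → 𝟙 (((false ∷ s) == (b ∷ t)) ∧ P (false ∷ s))) A) ≡ 𝟙 (P (b ∷ t))
  split true  = trans (cong (_+ sum (List.map (λ _ → 0) A)) (sum-allSubsets-== n t (P ∘ (true ∷_))))
                      (trans (cong (𝟙 (P (true ∷ t)) +_) (sum-map-0 A)) (+-identityʳ _))
  split false = trans (cong (_+ sum (List.map (λ s → 𝟙 ((s == t) ∧ P (false ∷ s))) A)) (sum-map-0 A))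
                      (sum-allSubsets-== n t (P ∘ (false ∷_)))

-- Double counting: an X₁-neighbour of {x,y,z} is {p,q,g} for exactly one pair {p,q} ⊂ {x,y,z} and one
-- g ∉ {x,y,z}.
nbrsIn₁-tri : ∀ (χ : Subset n → Bool) {x y z : Fin n} → x ≢ y → x ≢ z → y ≢ z →
  nbrsIn₁ χ (tri x y z) ≡
    countOutside (tri x y z) (bar χ x y) + (countOutside (tri x y z) (bar χ x z) + countOutside (tri x y z) (bar χ y z))
nbrsIn₁-tri {n} χ {x} {y} {z} x≢y x≢z y≢z = begin
  nbrsIn₁ χ v                                                           ≡⟨ length-filterᵇ-filterᵇ _ _ A ⟩
  sum (List.map (λ s → 𝟙 ((∣ s ∣ ≡ᵇ 3) ∧ (adjᵇ v s ∧ χ s))) A)           ≡⟨ cong sum (map-cong pointwise A) ⟩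
  sum (List.map (λ s → H (tri x y) s + (H (tri x z) s + H (tri y z) s)) A)
    ≡⟨ trans (sum-map-+ (H (tri x y)) _ A) (cong (∑H (tri x y) +_) (sum-map-+ (H (tri x z)) _ A)) ⟩
  ∑H (tri x y) + (∑H (tri x z) + ∑H (tri y z))
    ≡⟨ cong₂ _+_ (∑H≡ (tri x y)) (cong₂ _+_ (∑H≡ (tri x z)) (∑H≡ (tri y z))) ⟩
  countOutside v (bar χ x y) + (countOutside v (bar χ x z) + countOutside v (bar χ y z))
    ∎
  where
  open ≡-Reasoning
  v : Subset n
  v = tri x y z
  A : List (Subset n)
  A = allSubsets n
  H : (Fin n → Subset n) → Subset n → ℕ
  H t s = countOutside v (λ g → (s == t g) ∧ χ s)
  ∑H : (Fin n → Subset n) → ℕ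
  ∑H t = sum (List.map (H t) A)
  ∑H≡ : ∀ t → ∑H t ≡ countOutside v (χ ∘ t)
  ∑H≡ t = trans (sum-map-sumOutside v _ A) (sumOutside-cong v λ g _ → sum-allSubsets-== n (t g) χ)
  pointwise : ∀ s → 𝟙 ((∣ s ∣ ≡ᵇ 3) ∧ (adjᵇ v s ∧ χ s)) ≡ H (tri x y) s + (H (tri x z) s + H (tri y z) s)
  pointwise s rewrite sym (∧-assoc (∣ s ∣ ≡ᵇ 3) (adjᵇ v s) (χ s)) with χ s
  ... | true  = trans (cong 𝟙 (∧-identityʳ _)) (trans (neighbour-indicator x≢y x≢z y≢z s)
                  (cong₂ _+_ (∧true (tri x y)) (cong₂ _+_ (∧true (tri x z)) (∧true (tri y z)))))
    where
    ∧true : ∀ t → countOutside v (λ g → s == t g) ≡ countOutside v (λ g → (s == t g) ∧ true)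
    ∧true t = sumOutside-cong v λ g _ → cong 𝟙 (sym (∧-identityʳ _))
  ... | false =
    sym (cong₂ _+_ (∧false (tri x y))
                   (cong₂ _+_ (∧false (tri x z)) (trans (∧false (tri y z)) (sym (cong 𝟙 (∧-zeroʳ _))))))
    where
    ∧false : ∀ t → countOutside v (λ g → (s == t g) ∧ false) ≡ 0
    ∧false t = countOutside-none v λ g _ → ∧-zeroʳ _

+-≡-max : ∀ {k x y} → x ≤ k → y ≤ k → x + y ≡ k + k → x ≡ k
+-≡-max {k} {x} {y} x≤k y≤k x+y≡k+k with m≤n⇒m<n∨m≡n x≤k
... | inj₂ x≡k = x≡k
... | inj₁ x<k = contradiction x+y≡k+k (<⇒≢ (+-mono-<-≤ x<k y≤k))

equal-pair-sums : ∀ {k x y z} → x + y ≡ k → x + z ≡ k → y + z ≡ k → x + x ≡ k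
equal-pair-sums {k} {x} {y} {z} x+y≡k x+z≡k y+z≡k = trans (cong (x +_) x≡y) x+y≡k
  where
  y≡z : y ≡ z
  y≡z = +-cancelˡ-≡ x _ _ (trans x+y≡k (sym x+z≡k))
  x≡y : x ≡ y
  x≡y = +-cancelʳ-≡ y _ _ (trans x+y≡k (trans (sym y+z≡k) (cong (y +_) (sym y≡z))))

+-self-injective : ∀ {x y} → x + x ≡ y + y → x ≡ y
+-self-injective {zero}  {zero}  _  = refl
+-self-injective {suc x} {suc y} eq =
  cong suc (+-self-injective (suc-injective (trans (sym (+-suc x x)) (trans (suc-injective eq) (+-suc y y)))))

5≤x+x⇒3≤x : ∀ {x} → 5 ≤ x + x → 3 ≤ x
5≤x+x⇒3≤x {x} 5≤x+x = ≮⇒≥ λ x<3 → <⇒≱ (s≤s (+-mono-≤ (≤-pred x<3) (≤-pred x<3))) 5≤x+x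

module Configuration
  (χ : Subset n → Bool) {p₁₁ p₂₁ : ℕ}
  (X₁-degree : ∀ v → IsVertex v → χ v ≡ true → nbrsIn₁ χ v ≡ p₁₁)
  (X₂-degree : ∀ v → IsVertex v → χ v ≡ false → nbrsIn₁ χ v ≡ p₂₁)
  (λ₂ : p₁₁ + 7 ≡ n + p₂₁)
  {a b c d : Fin n} (a≢b : a ≢ b) (a≢c : a ≢ c) (b≢c : b ≢ c) (d≢a : d ≢ a) (d≢b : d ≢ b) (d≢c : d ≢ c)
  (abc : bar χ a b c ≡ true) (abd : bar χ a b d ≡ true) (acd : bar χ a c d ≡ true) (bcd : bar χ b c d ≡ true)
  (outside-abcd : ∀ f → f ≢ a → f ≢ b → f ≢ c → f ≢ d →
    bar χ a b f ≡ true × bar χ a c f ≡ true × bar χ b c f ≡ false)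
  where

  degree : Fin n → Fin n → Fin n → ℕ
  degree x y z =
    countOutside (tri x y z) (bar χ x y) + (countOutside (tri x y z) (bar χ x z) + countOutside (tri x y z) (bar χ y z))

  degree-X₁ : ∀ {x y z} → x ≢ y → x ≢ z → y ≢ z → bar χ x y z ≡ true → degree x y z ≡ p₁₁
  degree-X₁ x≢y x≢z y≢z xyz = trans (sym (nbrsIn₁-tri χ x≢y x≢z y≢z)) (X₁-degree _ (∣tri∣≡3 x≢y x≢z y≢z) xyz)

  degree-X₂ : ∀ {x y z} → x ≢ y → x ≢ z → y ≢ z → bar χ x y z ≡ false → degree x y z ≡ p₂₁
  degree-X₂ x≢y x≢z y≢z xyz = trans (sym (nbrsIn₁-tri χ x≢y x≢z y≢z)) (X₂-degree _ (∣tri∣≡3 x≢y x≢z y≢z) xyz)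

  abcd : Subset n
  abcd = ⋃⁅ a ∷ b ∷ c ∷ d ∷ [] ⁆

  m : ℕ
  m = countOutside abcd (λ _ → true)

  n≡4+m : n ≡ 4 + m
  n≡4+m = trans (sym countOutside-⊥)
    (countOutside-split ⊥ (a ∷ b ∷ c ∷ d ∷ []) (λ _ → true) (∉⊥ ∷ ∉⊥ ∷ ∉⊥ ∷ ∉⊥ ∷ [])
      ((a≢b ∷ a≢c ∷ ≢-sym d≢a ∷ []) ∷ (b≢c ∷ ≢-sym d≢b ∷ []) ∷ (≢-sym d≢c ∷ []) ∷ [] ∷ [])
      (∪-identityʳ abcd) (refl ∷ refl ∷ refl ∷ refl ∷ []))

  module _ {f : Fin n} (f∉abcd : f ∉ abcd) where

    ≢a : f ≢ a
    ≢a = x∉⁅y⁆⇒x≢y (∉-∪⁻ˡ _ f∉abcd)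

    ≢b : f ≢ b
    ≢b = x∉⁅y⁆⇒x≢y (∉-∪⁻ˡ _ (∉-∪⁻ʳ ⁅ a ⁆ f∉abcd))

    ≢c : f ≢ c
    ≢c = x∉⁅y⁆⇒x≢y (∉-∪⁻ˡ _ (∉-∪⁻ʳ ⁅ b ⁆ (∉-∪⁻ʳ ⁅ a ⁆ f∉abcd)))

    ≢d : f ≢ d
    ≢d = x∉⁅y⁆⇒x≢y (∉-∪⁻ˡ _ (∉-∪⁻ʳ ⁅ c ⁆ (∉-∪⁻ʳ ⁅ b ⁆ (∉-∪⁻ʳ ⁅ a ⁆ f∉abcd))))

    abf : bar χ a b f ≡ true
    abf = proj₁ (outside-abcd f ≢a ≢b ≢c ≢d)

    acf : bar χ a c f ≡ true
    acf = proj₁ (proj₂ (outside-abcd f ≢a ≢b ≢c ≢d))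

    bcf : bar χ b c f ≡ false
    bcf = proj₂ (proj₂ (outside-abcd f ≢a ≢b ≢c ≢d))

  ab-m : countOutside abcd (bar χ a b) ≡ m
  ab-m = countOutside-all abcd (λ _ → abf)

  ac-m : countOutside abcd (bar χ a c) ≡ m
  ac-m = countOutside-all abcd (λ _ → acf)

  bc-0 : countOutside abcd (bar χ b c) ≡ 0
  bc-0 = countOutside-none abcd (λ _ → bcf)

  p₁₁-via-abc : p₁₁ ≡ (1 + m) + ((1 + m) + 1)
  p₁₁-via-abc = trans (sym (degree-X₁ a≢b a≢c b≢c abc))
    (cong₂ _+_ (trans (at-d (bar χ a b) abd) (cong suc ab-m))
      (cong₂ _+_ (trans (at-d (bar χ a c) acd) (cong suc ac-m)) (trans (at-d (bar χ b c) bcd) (cong suc bc-0))))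
    where
    at-d : ∀ P {β} → P d ≡ β → countOutside (tri a b c) P ≡ sum (List.map 𝟙 (β ∷ [])) + countOutside abcd P
    at-d P Pd = countOutside-split (tri a b c) (d ∷ []) P (∉-tri d≢a d≢b d≢c ∷ []) ([] ∷ [])
      (solve 4 (λ a b c d → (d ⊕ id) ⊕ (a ⊕ (b ⊕ c)) ⊜ a ⊕ (b ⊕ (c ⊕ (d ⊕ id)))) refl ⁅ a ⁆ ⁅ b ⁆ ⁅ c ⁆ ⁅ d ⁆)
      (Pd ∷ [])

  p₁₁-via-abd : p₁₁ ≡ (1 + m) + ((1 + countOutside abcd (bar χ a d)) + (1 + countOutside abcd (bar χ b d)))
  p₁₁-via-abd = trans (sym (degree-X₁ a≢b (≢-sym d≢a) (≢-sym d≢b) abd))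
    (cong₂ _+_ (trans (at-c (bar χ a b) abc) (cong suc ab-m))
      (cong₂ _+_ (at-c (bar χ a d) (trans (bar-swap₂₃ a d c χ) acd))
                 (at-c (bar χ b d) (trans (bar-swap₂₃ b d c χ) bcd))))
    where
    at-c : ∀ P {β} → P c ≡ β → countOutside (tri a b d) P ≡ sum (List.map 𝟙 (β ∷ [])) + countOutside abcd P
    at-c P Pc = countOutside-split (tri a b d) (c ∷ []) P (∉-tri (≢-sym a≢c) (≢-sym b≢c) (≢-sym d≢c) ∷ []) ([] ∷ [])
      (solve 4 (λ a b c d → (c ⊕ id) ⊕ (a ⊕ (b ⊕ d)) ⊜ a ⊕ (b ⊕ (c ⊕ (d ⊕ id)))) refl ⁅ a ⁆ ⁅ b ⁆ ⁅ c ⁆ ⁅ d ⁆)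
      (Pc ∷ [])

  p₁₁-via-bcd : p₁₁ ≡ 1 + ((1 + countOutside abcd (bar χ b d)) + (1 + countOutside abcd (bar χ c d)))
  p₁₁-via-bcd = trans (sym (degree-X₁ b≢c (≢-sym d≢b) (≢-sym d≢c) bcd))
    (cong₂ _+_ (trans (at-a (bar χ b c) (trans (sym (bar-rotate a b c χ)) abc)) (cong suc bc-0))
      (cong₂ _+_ (at-a (bar χ b d) (trans (sym (bar-rotate a b d χ)) abd))
                 (at-a (bar χ c d) (trans (sym (bar-rotate a c d χ)) acd))))
    where
    at-a : ∀ P {β} → P a ≡ β → countOutside (tri b c d) P ≡ sum (List.map 𝟙 (β ∷ [])) + countOutside abcd P
    at-a P Pa = countOutside-split (tri b c d) (a ∷ []) P (∉-tri a≢b a≢c (≢-sym d≢a) ∷ []) ([] ∷ [])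
      (solve 4 (λ a b c d → (a ⊕ id) ⊕ (b ⊕ (c ⊕ d)) ⊜ a ⊕ (b ⊕ (c ⊕ (d ⊕ id)))) refl ⁅ a ⁆ ⁅ b ⁆ ⁅ c ⁆ ⁅ d ⁆)
      (Pa ∷ [])

  p₁₁≡3+2m : p₁₁ ≡ 3 + (m + m)
  p₁₁≡3+2m = trans p₁₁-via-abc (normalise m)
    where
    normalise : ∀ m → (1 + m) + ((1 + m) + 1) ≡ 3 + (m + m)
    normalise = solve-∀

  private
    Tad Tbd Tcd : ℕ
    Tad = countOutside abcd (bar χ a d)
    Tbd = countOutside abcd (bar χ b d)
    Tcd = countOutside abcd (bar χ c d)

    Tbd+Tcd≡m+m : Tbd + Tcd ≡ m + m
    Tbd+Tcd≡m+m = +-cancelˡ-≡ 3 _ _ (begin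
      3 + (Tbd + Tcd)                 ≡⟨ normalise Tbd Tcd ⟩
      1 + ((1 + Tbd) + (1 + Tcd))     ≡⟨ sym p₁₁-via-bcd ⟩
      p₁₁                             ≡⟨ p₁₁≡3+2m ⟩
      3 + (m + m)                     ∎)
      where
      open ≡-Reasoning
      normalise : ∀ x y → 3 + (x + y) ≡ 1 + ((1 + x) + (1 + y))
      normalise = solve-∀

  bd-m : countOutside abcd (bar χ b d) ≡ m
  bd-m = +-≡-max (countOutside-≤ abcd _) (countOutside-≤ abcd _) Tbd+Tcd≡m+m

  cd-m : countOutside abcd (bar χ c d) ≡ m
  cd-m = +-≡-max (countOutside-≤ abcd _) (countOutside-≤ abcd _) (trans (+-comm Tcd Tbd) Tbd+Tcd≡m+m)

  ad-0 : countOutside abcd (bar χ a d) ≡ 0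
  ad-0 = +-cancelʳ-≡ m _ _ (+-cancelˡ-≡ (3 + m) _ _ (begin
    3 + m + (Tad + m)                   ≡⟨ normalise m Tad ⟩
    (1 + m) + ((1 + Tad) + (1 + m))     ≡⟨ cong (λ t → (1 + m) + ((1 + Tad) + (1 + t))) bd-m ⟨
    (1 + m) + ((1 + Tad) + (1 + Tbd))   ≡⟨ sym p₁₁-via-abd ⟩
    p₁₁                                 ≡⟨ p₁₁≡3+2m ⟩
    3 + (m + m)                         ≡⟨ +-assoc 3 m m ⟨
    3 + m + (0 + m)                     ∎))
    where
    open ≡-Reasoning
    normalise : ∀ m x → 3 + m + (x + m) ≡ (1 + m) + ((1 + x) + (1 + m))
    normalise = solve-∀

  p₂₁≡6+m : p₂₁ ≡ 6 + m
  p₂₁≡6+m = +-cancelˡ-≡ (4 + m) _ _ (begin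
    (4 + m) + p₂₁          ≡⟨ cong (_+ p₂₁) n≡4+m ⟨
    n + p₂₁                ≡⟨ λ₂ ⟨
    p₁₁ + 7                ≡⟨ cong (_+ 7) p₁₁≡3+2m ⟩
    3 + (m + m) + 7        ≡⟨ normalise m ⟩
    (4 + m) + (6 + m)      ∎)
    where
    open ≡-Reasoning
    normalise : ∀ m → 3 + (m + m) + 7 ≡ (4 + m) + (6 + m)
    normalise = solve-∀

  module _ {f : Fin n} (f∉abcd : f ∉ abcd) where

    adf : bar χ a d f ≡ false
    adf = countOutside-≡0⇒ abcd ad-0 f∉abcd

    bdf : bar χ b d f ≡ true
    bdf = countOutside-full⇒ abcd bd-m f∉abcd

    cdf : bar χ c d f ≡ true
    cdf = countOutside-full⇒ abcd cd-m f∉abcd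

  module _ (f : Fin n) where

    m′ A B C : ℕ
    m′ = countOutside (⁅ f ⁆ ∪ abcd) (λ _ → true)
    A  = countOutside (⁅ f ⁆ ∪ abcd) (bar χ a f)
    B  = countOutside (⁅ f ⁆ ∪ abcd) (bar χ b f)
    C  = countOutside (⁅ f ⁆ ∪ abcd) (bar χ c f)

  module _ {f : Fin n} (f∉abcd : f ∉ abcd) where

    private
      countOutside-f-all : ∀ {P} → (∀ {k} → k ∉ abcd → P k ≡ true) → countOutside (⁅ f ⁆ ∪ abcd) P ≡ m′ f
      countOutside-f-all P-true = countOutside-all (⁅ f ⁆ ∪ abcd) (λ _ k∉ → P-true (∉-∪⁻ʳ ⁅ f ⁆ k∉))

      SplitsAt : Fin n → Fin n → Fin n → Fin n → Set
      SplitsAt x y u w = ∀ P {β γ} → P u ≡ β → P w ≡ γ →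
        countOutside (tri x y f) P ≡ sum (List.map 𝟙 (β ∷ γ ∷ [])) + countOutside (⁅ f ⁆ ∪ abcd) P

      split : ∀ {x y u w} → u ∉ tri x y f → w ∉ tri x y f → u ≢ w →
        ⋃⁅ u ∷ w ∷ [] ⁆ ∪ tri x y f ≡ ⁅ f ⁆ ∪ abcd → SplitsAt x y u w
      split u∉ w∉ u≢w eq P Pu Pw =
        countOutside-split _ (_ ∷ _ ∷ []) P (u∉ ∷ w∉ ∷ []) ((u≢w ∷ []) ∷ [] ∷ []) eq (Pu ∷ Pw ∷ [])

    m≡1+m′ : m ≡ 1 + m′ f
    m≡1+m′ = sumOutside-split abcd (λ _ → 1) f∉abcd

    p₁₁-via-abf : p₁₁ ≡ (2 + m′ f) + ((1 + A f) + (1 + B f))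
    p₁₁-via-abf = trans (sym (degree-X₁ a≢b (≢-sym (≢a f∉abcd)) (≢-sym (≢b f∉abcd)) (abf f∉abcd)))
      (cong₂ _+_ (trans (at-cd (bar χ a b) abc abd) (cong (2 +_) (countOutside-f-all abf)))
        (cong₂ _+_ (at-cd (bar χ a f) (trans (bar-swap₂₃ a f c χ) (acf f∉abcd))
                     (trans (bar-swap₂₃ a f d χ) (adf f∉abcd)))
                   (at-cd (bar χ b f) (trans (bar-swap₂₃ b f c χ) (bcf f∉abcd))
                     (trans (bar-swap₂₃ b f d χ) (bdf f∉abcd)))))
      where
      at-cd : SplitsAt a b c d
      at-cd = split
        (∉-tri (≢-sym a≢c) (≢-sym b≢c) (≢-sym (≢c f∉abcd))) (∉-tri d≢a d≢b (≢-sym (≢d f∉abcd))) (≢-sym d≢c)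
        (solve 5 (λ a b c d f → (c ⊕ (d ⊕ id)) ⊕ (a ⊕ (b ⊕ f)) ⊜ f ⊕ (a ⊕ (b ⊕ (c ⊕ (d ⊕ id)))))
          refl ⁅ a ⁆ ⁅ b ⁆ ⁅ c ⁆ ⁅ d ⁆ ⁅ f ⁆)

    p₁₁-via-acf : p₁₁ ≡ (2 + m′ f) + ((1 + A f) + (1 + C f))
    p₁₁-via-acf = trans (sym (degree-X₁ a≢c (≢-sym (≢a f∉abcd)) (≢-sym (≢c f∉abcd)) (acf f∉abcd)))
      (cong₂ _+_ (trans (at-bd (bar χ a c) (trans (bar-swap₂₃ a c b χ) abc) acd) (cong (2 +_) (countOutside-f-all acf)))
        (cong₂ _+_ (at-bd (bar χ a f) (trans (bar-swap₂₃ a f b χ) (abf f∉abcd))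
                     (trans (bar-swap₂₃ a f d χ) (adf f∉abcd)))
                   (at-bd (bar χ c f) (trans (sym (bar-rotate b c f χ)) (bcf f∉abcd))
                     (trans (bar-swap₂₃ c f d χ) (cdf f∉abcd)))))
      where
      at-bd : SplitsAt a c b d
      at-bd = split
        (∉-tri (≢-sym a≢b) b≢c (≢-sym (≢b f∉abcd))) (∉-tri d≢a d≢c (≢-sym (≢d f∉abcd))) (≢-sym d≢b)
        (solve 5 (λ a b c d f → (b ⊕ (d ⊕ id)) ⊕ (a ⊕ (c ⊕ f)) ⊜ f ⊕ (a ⊕ (b ⊕ (c ⊕ (d ⊕ id)))))
          refl ⁅ a ⁆ ⁅ b ⁆ ⁅ c ⁆ ⁅ d ⁆ ⁅ f ⁆)

    p₂₁-via-bcf : p₂₁ ≡ 2 + ((2 + B f) + (2 + C f))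
    p₂₁-via-bcf = trans (sym (degree-X₂ b≢c (≢-sym (≢b f∉abcd)) (≢-sym (≢c f∉abcd)) (bcf f∉abcd)))
      (cong₂ _+_ (trans (at-ad (bar χ b c) (trans (sym (bar-rotate a b c χ)) abc) bcd)
                        (cong (2 +_) (countOutside-none (⁅ f ⁆ ∪ abcd) (λ _ k∉ → bcf (∉-∪⁻ʳ ⁅ f ⁆ k∉)))))
        (cong₂ _+_ (at-ad (bar χ b f) (trans (sym (bar-rotate a b f χ)) (abf f∉abcd))
                     (trans (bar-swap₂₃ b f d χ) (bdf f∉abcd)))
                   (at-ad (bar χ c f) (trans (sym (bar-rotate a c f χ)) (acf f∉abcd))
                     (trans (bar-swap₂₃ c f d χ) (cdf f∉abcd)))))
      where
      at-ad : SplitsAt b c a d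
      at-ad = split
        (∉-tri a≢b a≢c (≢-sym (≢a f∉abcd))) (∉-tri d≢b d≢c (≢-sym (≢d f∉abcd))) (≢-sym d≢a)
        (solve 5 (λ a b c d f → (a ⊕ (d ⊕ id)) ⊕ (b ⊕ (c ⊕ f)) ⊜ f ⊕ (a ⊕ (b ⊕ (c ⊕ (d ⊕ id)))))
          refl ⁅ a ⁆ ⁅ b ⁆ ⁅ c ⁆ ⁅ d ⁆ ⁅ f ⁆)

    private
      sum≡m : ∀ {x y} → p₁₁ ≡ (2 + m′ f) + ((1 + x) + (1 + y)) → x + y ≡ m
      sum≡m {x} {y} p≡ = +-cancelˡ-≡ (4 + m′ f) _ _ (begin
        4 + m′ f + (x + y)                  ≡⟨ normalise (m′ f) x y ⟩
        (2 + m′ f) + ((1 + x) + (1 + y))    ≡⟨ sym p≡ ⟩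
        p₁₁                                 ≡⟨ p₁₁≡3+2m ⟩
        3 + (m + m)                         ≡⟨ cong (λ t → 3 + (t + m)) m≡1+m′ ⟩
        3 + ((1 + m′ f) + m)                ≡⟨ +-assoc 4 (m′ f) m ⟨
        4 + m′ f + m                        ∎)
        where
        open ≡-Reasoning
        normalise : ∀ m′ x y → 4 + m′ + (x + y) ≡ (2 + m′) + ((1 + x) + (1 + y))
        normalise = solve-∀

      B+C≡m : B f + C f ≡ m
      B+C≡m = +-cancelˡ-≡ 6 _ _ (trans (normalise (B f) (C f)) (trans (sym p₂₁-via-bcf) p₂₁≡6+m))
        where
        normalise : ∀ x y → 6 + (x + y) ≡ 2 + ((2 + x) + (2 + y))
        normalise = solve-∀

    A+A≡m : A f + A f ≡ m
    A+A≡m = equal-pair-sums {y = B f} {z = C f} (sum≡m p₁₁-via-abf) (sum≡m p₁₁-via-acf) B+C≡m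

  colour : Fin n → Fin n → Bool
  colour f g = bar χ a f g

  K : Fin n → Fin n → ℕ
  K f g = countOutside (tri a f g) (bar χ f g)

  -- The value of 𝟙 (colour f g) + K f g forced by the degree of afg (colour+K).
  κ : Bool → ℕ
  κ true  = 2 + m
  κ false = 2

  module _ {f g : Fin n} (f∉abcd : f ∉ abcd) (g∉abcd : g ∉ abcd) (g≢f : g ≢ f) where

    private
      W : Subset n
      W = ⁅ g ⁆ ∪ ⁅ f ⁆ ∪ abcd

      at-bcd : ∀ P {β γ δ} → P b ≡ β → P c ≡ γ → P d ≡ δ →
        countOutside (tri a f g) P ≡ sum (List.map 𝟙 (β ∷ γ ∷ δ ∷ [])) + countOutside W P
      at-bcd P Pb Pc Pd = countOutside-split (tri a f g) (b ∷ c ∷ d ∷ []) P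
        ( ∉-tri (≢-sym a≢b) (≢-sym (≢b f∉abcd)) (≢-sym (≢b g∉abcd))
        ∷ ∉-tri (≢-sym a≢c) (≢-sym (≢c f∉abcd)) (≢-sym (≢c g∉abcd))
        ∷ ∉-tri d≢a (≢-sym (≢d f∉abcd)) (≢-sym (≢d g∉abcd)) ∷ [])
        ((b≢c ∷ ≢-sym d≢b ∷ []) ∷ (≢-sym d≢c ∷ []) ∷ [] ∷ [])
        (solve 6 (λ a b c d f g → (b ⊕ (c ⊕ (d ⊕ id))) ⊕ (a ⊕ (f ⊕ g)) ⊜ g ⊕ (f ⊕ (a ⊕ (b ⊕ (c ⊕ (d ⊕ id))))))
          refl ⁅ a ⁆ ⁅ b ⁆ ⁅ c ⁆ ⁅ d ⁆ ⁅ f ⁆ ⁅ g ⁆)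
        (Pb ∷ Pc ∷ Pd ∷ [])

      degree-afg : degree a f g ≡ (2 + countOutside W (bar χ a f)) + ((2 + countOutside W (bar χ a g)) + K f g)
      degree-afg = cong₂ _+_
        (at-bcd (bar χ a f) (trans (bar-swap₂₃ a f b χ) (abf f∉abcd)) (trans (bar-swap₂₃ a f c χ) (acf f∉abcd))
          (trans (bar-swap₂₃ a f d χ) (adf f∉abcd)))
        (cong (_+ K f g) (at-bcd (bar χ a g) (trans (bar-swap₂₃ a g b χ) (abf g∉abcd))
          (trans (bar-swap₂₃ a g c χ) (acf g∉abcd)) (trans (bar-swap₂₃ a g d χ) (adf g∉abcd))))

      A-f : A f ≡ 𝟙 (colour f g) + countOutside W (bar χ a f)
      A-f = sumOutside-split (⁅ f ⁆ ∪ abcd) _ (∉-∪ (≢⇒∉⁅⁆ g≢f) g∉abcd)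

      A-g : A g ≡ 𝟙 (colour f g) + countOutside W (bar χ a g)
      A-g = trans (sumOutside-split (⁅ g ⁆ ∪ abcd) _ (∉-∪ (≢⇒∉⁅⁆ (≢-sym g≢f)) f∉abcd))
        (cong₂ (λ β T → 𝟙 β + countOutside T (bar χ a g)) (bar-swap₂₃ a g f χ)
          (solve 3 (λ f g X → f ⊕ (g ⊕ X) ⊜ g ⊕ (f ⊕ X)) refl ⁅ f ⁆ ⁅ g ⁆ abcd))

      Af+Ag≡m : A f + A g ≡ m
      Af+Ag≡m =
        trans (cong (A f +_) (sym (+-self-injective (trans (A+A≡m f∉abcd) (sym (A+A≡m g∉abcd)))))) (A+A≡m f∉abcd)

      afg-equation : degree a f g + (𝟙 (colour f g) + 𝟙 (colour f g)) ≡ 4 + m + K f g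
      afg-equation = begin
        degree a f g + (𝟙 β + 𝟙 β)                          ≡⟨ cong (_+ (𝟙 β + 𝟙 β)) degree-afg ⟩
        (2 + Wf) + ((2 + Wg) + K f g) + (𝟙 β + 𝟙 β)         ≡⟨ normalise Wf Wg (K f g) (𝟙 β) ⟩
        4 + ((𝟙 β + Wf) + (𝟙 β + Wg)) + K f g                ≡⟨ cong (λ t → 4 + t + K f g) (cong₂ _+_ A-f A-g) ⟨
        4 + (A f + A g) + K f g                              ≡⟨ cong (λ t → 4 + t + K f g) Af+Ag≡m ⟩
        4 + m + K f g                                        ∎
        where
        open ≡-Reasoning
        β : Bool
        β = colour f g
        Wf Wg : ℕ
        Wf = countOutside W (bar χ a f)
        Wg = countOutside W (bar χ a g)
        normalise : ∀ x y k e → (2 + x) + ((2 + y) + k) + (e + e) ≡ 4 + ((e + x) + (e + y)) + k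
        normalise = solve-∀

    colour+K : 𝟙 (colour f g) + K f g ≡ κ (colour f g)
    colour+K = by-colour refl afg-equation
      where
      open ≡-Reasoning
      by-colour : ∀ {β} → colour f g ≡ β → degree a f g + (𝟙 β + 𝟙 β) ≡ 4 + m + K f g → 𝟙 β + K f g ≡ κ β
      by-colour {true}  fg eq = cong suc (sym (+-cancelˡ-≡ (4 + m) _ _ (begin
        4 + m + (1 + m)           ≡⟨ normalise m ⟩
        3 + (m + m) + 2           ≡⟨ cong (_+ 2) p₁₁≡3+2m ⟨
        p₁₁ + 2                   ≡⟨ cong (_+ 2) (degree-X₁ (≢-sym (≢a f∉abcd)) (≢-sym (≢a g∉abcd)) (≢-sym g≢f) fg) ⟨
        degree a f g + 2          ≡⟨ eq ⟩
        4 + m + K f g             ∎)))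
        where
        normalise : ∀ m → 4 + m + (1 + m) ≡ 3 + (m + m) + 2
        normalise = solve-∀
      by-colour {false} fg eq = sym (+-cancelˡ-≡ (4 + m) _ _ (begin
        4 + m + 2                 ≡⟨ normalise m ⟩
        6 + m + 0                 ≡⟨ cong (_+ 0) p₂₁≡6+m ⟨
        p₂₁ + 0                   ≡⟨ cong (_+ 0) (degree-X₂ (≢-sym (≢a f∉abcd)) (≢-sym (≢a g∉abcd)) (≢-sym g≢f) fg) ⟨
        degree a f g + 0          ≡⟨ eq ⟩
        4 + m + K f g             ∎))
        where
        normalise : ∀ m → 4 + m + 2 ≡ 6 + m + 0
        normalise = solve-∀

  degreeOf : Bool → ℕ
  degreeOf true  = p₁₁
  degreeOf false = p₂₁

  triangle-arith : ∀ τ β → degreeOf τ + (𝟙 τ + (𝟙 τ + 𝟙 τ)) ≡ κ β + (κ β + κ β) → m ≡ 0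
  triangle-arith true  true  eq = sym (+-cancelˡ-≡ (6 + (m + m)) 0 m (begin
    6 + (m + m) + 0                   ≡⟨ normalise m ⟩
    3 + (m + m) + 3                   ≡⟨ cong (_+ 3) p₁₁≡3+2m ⟨
    p₁₁ + 3                           ≡⟨ eq ⟩
    (2 + m) + ((2 + m) + (2 + m))     ≡⟨ normalise′ m ⟩
    6 + (m + m) + m                   ∎))
    where
    open ≡-Reasoning
    normalise : ∀ m → 6 + (m + m) + 0 ≡ 3 + (m + m) + 3
    normalise = solve-∀
    normalise′ : ∀ m → (2 + m) + ((2 + m) + (2 + m)) ≡ 6 + (m + m) + m
    normalise′ = solve-∀
  triangle-arith true  false eq = m+n≡0⇒m≡0 m (+-cancelˡ-≡ 6 (m + m) 0 (begin
    6 + (m + m)                       ≡⟨ normalise m ⟩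
    3 + (m + m) + 3                   ≡⟨ cong (_+ 3) p₁₁≡3+2m ⟨
    p₁₁ + 3                           ≡⟨ eq ⟩
    6                                 ∎))
    where
    open ≡-Reasoning
    normalise : ∀ m → 6 + (m + m) ≡ 3 + (m + m) + 3
    normalise = solve-∀
  triangle-arith false true  eq = m+n≡0⇒m≡0 m (sym (+-cancelˡ-≡ (6 + m) 0 (m + m) (begin
    6 + m + 0                         ≡⟨ cong (_+ 0) p₂₁≡6+m ⟨
    p₂₁ + 0                           ≡⟨ eq ⟩
    (2 + m) + ((2 + m) + (2 + m))     ≡⟨ normalise m ⟩
    6 + m + (m + m)                   ∎)))
    where
    open ≡-Reasoning
    normalise : ∀ m → (2 + m) + ((2 + m) + (2 + m)) ≡ 6 + m + (m + m)
    normalise = solve-∀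
  triangle-arith false false eq = +-cancelˡ-≡ 6 m 0 (begin
    6 + m                             ≡⟨ +-identityʳ (6 + m) ⟨
    6 + m + 0                         ≡⟨ cong (_+ 0) p₂₁≡6+m ⟨
    p₂₁ + 0                           ≡⟨ eq ⟩
    6                                 ∎)
    where open ≡-Reasoning

  module _ {f g h : Fin n} (f∉abcd : f ∉ abcd) (g∉abcd : g ∉ abcd) (h∉abcd : h ∉ abcd)
           (g≢f : g ≢ f) (h≢f : h ≢ f) (h≢g : h ≢ g) where

    private
      t : Bool
      t = bar χ f g h

      W : Subset n
      W = ⁅ a ⁆ ∪ tri f g h

      a∉fgh : a ∉ tri f g h
      a∉fgh = ∉-tri (≢-sym (≢a f∉abcd)) (≢-sym (≢a g∉abcd)) (≢-sym (≢a h∉abcd))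

      fg-exchange : countOutside (tri f g h) (bar χ f g) + 𝟙 t ≡ 𝟙 (colour f g) + K f g
      fg-exchange = trans
        (countOutside-exchange (bar χ f g) a∉fgh (∉-tri (≢a h∉abcd) h≢f h≢g) refl
          (solve 4 (λ a f g h → h ⊕ (a ⊕ (f ⊕ g)) ⊜ a ⊕ (f ⊕ (g ⊕ h))) refl ⁅ a ⁆ ⁅ f ⁆ ⁅ g ⁆ ⁅ h ⁆))
        (cong (λ β → 𝟙 β + K f g) (sym (bar-rotate a f g χ)))

      fh-exchange : countOutside (tri f g h) (bar χ f h) + 𝟙 t ≡ 𝟙 (colour f h) + K f h
      fh-exchange = trans (cong (λ β → countOutside (tri f g h) (bar χ f h) + 𝟙 β) (bar-swap₂₃ f g h χ))
        (trans (countOutside-exchange (bar χ f h) a∉fgh (∉-tri (≢a g∉abcd) g≢f (≢-sym h≢g)) refl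
                 (solve 4 (λ a f g h → g ⊕ (a ⊕ (f ⊕ h)) ⊜ a ⊕ (f ⊕ (g ⊕ h))) refl ⁅ a ⁆ ⁅ f ⁆ ⁅ g ⁆ ⁅ h ⁆))
               (cong (λ β → 𝟙 β + K f h) (sym (bar-rotate a f h χ))))

      gh-exchange : countOutside (tri f g h) (bar χ g h) + 𝟙 t ≡ 𝟙 (colour g h) + K g h
      gh-exchange = trans (cong (λ β → countOutside (tri f g h) (bar χ g h) + 𝟙 β) (bar-rotate f g h χ))
        (trans (countOutside-exchange (bar χ g h) a∉fgh (∉-tri (≢a f∉abcd) (≢-sym g≢f) (≢-sym h≢f)) refl
                 (solve 4 (λ a f g h → f ⊕ (a ⊕ (g ⊕ h)) ⊜ a ⊕ (f ⊕ (g ⊕ h))) refl ⁅ a ⁆ ⁅ f ⁆ ⁅ g ⁆ ⁅ h ⁆))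
               (cong (λ β → 𝟙 β + K g h) (sym (bar-rotate a g h χ))))

      fgh-equation : degree f g h + (𝟙 t + (𝟙 t + 𝟙 t)) ≡
        (𝟙 (colour f g) + K f g) + ((𝟙 (colour f h) + K f h) + (𝟙 (colour g h) + K g h))
      fgh-equation = trans (normalise (countOutside (tri f g h) (bar χ f g)) (countOutside (tri f g h) (bar χ f h))
                                         (countOutside (tri f g h) (bar χ g h)) (𝟙 t))
        (cong₂ _+_ fg-exchange (cong₂ _+_ fh-exchange gh-exchange))
        where
        normalise : ∀ x y z e → x + (y + z) + (e + (e + e)) ≡ (x + e) + ((y + e) + (z + e))
        normalise = solve-∀

    monochromatic⇒m≡0 : ∀ {β} → colour f g ≡ β → colour f h ≡ β → colour g h ≡ β → m ≡ 0
    monochromatic⇒m≡0 {β} fg fh gh = by-type refl (begin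
      degree f g h + (𝟙 t + (𝟙 t + 𝟙 t))                                    ≡⟨ fgh-equation ⟩
      (𝟙 (colour f g) + K f g) + ((𝟙 (colour f h) + K f h) + (𝟙 (colour g h) + K g h))
        ≡⟨ cong₂ _+_ (κ-of fg f∉abcd g∉abcd g≢f) (cong₂ _+_ (κ-of fh f∉abcd h∉abcd h≢f) (κ-of gh g∉abcd h∉abcd h≢g)) ⟩
      κ β + (κ β + κ β)                                                      ∎)
      where
      open ≡-Reasoning
      κ-of : ∀ {x y} → colour x y ≡ β → x ∉ abcd → y ∉ abcd → y ≢ x → 𝟙 (colour x y) + K x y ≡ κ β
      κ-of xy x∉ y∉ y≢x = trans (colour+K x∉ y∉ y≢x) (cong κ xy)
      by-type : ∀ {τ} → t ≡ τ → degree f g h + (𝟙 τ + (𝟙 τ + 𝟙 τ)) ≡ κ β + (κ β + κ β) → m ≡ 0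
      by-type {true}  fgh eq =
        triangle-arith true β (trans (cong (_+ 3) (sym (degree-X₁ (≢-sym g≢f) (≢-sym h≢f) (≢-sym h≢g) fgh))) eq)
      by-type {false} fgh eq =
        triangle-arith false β (trans (cong (_+ 0) (sym (degree-X₂ (≢-sym g≢f) (≢-sym h≢f) (≢-sym h≢g) fgh))) eq)

  three-neighbours⇒m≡0 : ∀ {f g h k} → f ∉ abcd → g ∉ ⁅ f ⁆ ∪ abcd → h ∉ ⁅ f ⁆ ∪ abcd → k ∉ ⁅ f ⁆ ∪ abcd →
    h ≢ g → k ≢ g → k ≢ h → colour f g ≡ true → colour f h ≡ true → colour f k ≡ true → m ≡ 0
  three-neighbours⇒m≡0 {f} {g} {h} {k} f∉abcd g∉ h∉ k∉ h≢g k≢g k≢h fg fh fk = by-colours refl refl refl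
    where
    g∉abcd : g ∉ abcd
    g∉abcd = ∉-∪⁻ʳ ⁅ f ⁆ g∉
    h∉abcd : h ∉ abcd
    h∉abcd = ∉-∪⁻ʳ ⁅ f ⁆ h∉
    k∉abcd : k ∉ abcd
    k∉abcd = ∉-∪⁻ʳ ⁅ f ⁆ k∉
    g≢f : g ≢ f
    g≢f = x∉⁅y⁆⇒x≢y (∉-∪⁻ˡ abcd g∉)
    h≢f : h ≢ f
    h≢f = x∉⁅y⁆⇒x≢y (∉-∪⁻ˡ abcd h∉)
    k≢f : k ≢ f
    k≢f = x∉⁅y⁆⇒x≢y (∉-∪⁻ˡ abcd k∉)
    by-colours : ∀ {β₁ β₂ β₃} → colour g h ≡ β₁ → colour g k ≡ β₂ → colour h k ≡ β₃ → m ≡ 0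
    by-colours {true}                gh _  _  = monochromatic⇒m≡0 f∉abcd g∉abcd h∉abcd g≢f h≢f h≢g fg fh gh
    by-colours {false} {true}        _  gk _  = monochromatic⇒m≡0 f∉abcd g∉abcd k∉abcd g≢f k≢f k≢g fg fk gk
    by-colours {false} {false} {true} _ _  hk = monochromatic⇒m≡0 f∉abcd h∉abcd k∉abcd h≢f k≢f k≢h fh fk hk
    by-colours {false} {false} {false} gh gk hk = monochromatic⇒m≡0 g∉abcd h∉abcd k∉abcd h≢g k≢g k≢h gh gk hk

  m≤4 : m ≤ 4
  m≤4 = ≮⇒≥ λ 4<m →
    let o , 5+o≡m = m≤n⇒∃[o]m+o≡n 4<m
        f , f∉abcd , _ , _ = countOutside-pick abcd (λ _ → true) (sym 5+o≡m)
        r , 3+r≡A = m≤n⇒∃[o]m+o≡n (5≤x+x⇒3≤x (subst (5 ≤_) (sym (A+A≡m f∉abcd)) 4<m))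
        g , h , k , g∉ , h∉ , k∉ , h≢g , k≢g , k≢h , fg , fh , fk =
          countOutside-pick₃ (⁅ f ⁆ ∪ abcd) (colour f) (sym 3+r≡A)
    in contradiction (trans (sym (m≡1+m′ f∉abcd)) (three-neighbours⇒m≡0 f∉abcd g∉ h∉ k∉ h≢g k≢g k≢h fg fh fk)) λ ()

  n≤8 : n ≤ 8
  n≤8 = subst (_≤ 8) (sym n≡4+m) (+-monoʳ-≤ 4 m≤4)

Lambda2⇒ : ∀ {n p q} → Lambda2 n p q → p + 7 ≡ n + q
Lambda2⇒ {n} {p} {q} eq = ℤₚ.+-injective (begin
  + p +ᶻ + 7                     ≡⟨ regroup (+ p) (+ q) (+ 7) ⟩
  (+ p - + q) +ᶻ (+ q +ᶻ + 7)    ≡⟨ cong (_+ᶻ (+ q +ᶻ + 7)) eq ⟩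
  (+ n - + 7) +ᶻ (+ q +ᶻ + 7)    ≡⟨ regroup′ (+ n) (+ q) (+ 7) ⟩
  + n +ᶻ + q                     ∎)
  where
  open ≡-Reasoning
  open ℤ using (+_; _-_) renaming (_+_ to _+ᶻ_)
  regroup : ∀ x y z → x +ᶻ z ≡ (x - y) +ᶻ (y +ᶻ z)
  regroup = ℤ-solve-∀
  regroup′ : ∀ x y z → (x - z) +ᶻ (y +ᶻ z) ≡ x +ᶻ y
  regroup′ = ℤ-solve-∀

-- Opened only here: Data.Integer's prefix +_ would make sections such as (x +_) above ambiguous.
open import Data.Integer using (+_; _-_; _*_) renaming (_≤_ to _≤ℤ_)

mainTheorem16 : (n : ℕ) (χ : Subset n → Bool) (p₁₁ p₁₂ p₂₁ p₂₂ : ℕ) →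
    Equitable2Partition n χ p₁₁ p₁₂ p₂₁ p₂₂ →
    Lambda2 n p₁₁ p₂₁ →
    p₂₂ ≤ p₁₁ →
    (+ 2) * (+ n) - (+ 7) ≤ℤ (+ p₁₁) →
    (∀ x y z → ¬ TypeI n χ x y z) →
    (∀ x y z → ¬ TypeII n χ x y z) →
    (a b c d : Fin n) →
    a ≢ b → a ≢ c → b ≢ c → d ≢ a → d ≢ b → d ≢ c →
    bar χ a b c ≡ true →
    bar χ a b d ≡ true → bar χ a c d ≡ true → bar χ b c d ≡ true →
    (∀ f → f ≢ a → f ≢ b → f ≢ c → f ≢ d →
      (bar χ a b f ≡ true × bar χ a c f ≡ true × bar χ b c f ≡ false)) →
    n ≤ 8
-- Only the rows p₁₁, p₂₁ and the λ₂ condition enter the argument.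
mainTheorem16 n χ p₁₁ p₁₂ p₂₁ p₂₂ X λ₂ _ _ _ _ a b c d a≢b a≢c b≢c d≢a d≢b d≢c abc abd acd bcd others =
  Configuration.n≤8 χ (row₁₁ X) (row₂₁ X) (Lambda2⇒ {n} {p₁₁} {p₂₁} λ₂) a≢b a≢c b≢c d≢a d≢b d≢c abc abd acd bcd others
  where open Equitable2Partition
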